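{- Let $n,c$ be positive integers, let $k_1,\dots,k_n$ be nonnegative integers, and let $G=\bigoplus_{i=1}^n \frac{1}{2^{k_i+1}}\mathbb{Z}/\mathbb{Z}$. Let $H$ be a subgroup of $G$ and let $M_1,\dots,M_{2^c-1}$ be subsets of $G$. Then there exist cosets $H_1,\dots,H_c\in G/H$ of $H$ such that for every $1\le i\le c$, $$\frac{1}{|H|}\sum_{x\in\{0,1\}^{i-1}}\left|M_{2^{i-1}+\sum_{j=1}^{i-1}x_j2^{j-1}}\cap\Big(H_i+\sum_{j=1}^{i-1}x_jH_j\Big)\right|\ \ge\ \sum_{j=2^{i-1}}^{2^i-1}\frac{|M_j|}{|G|}.$$
   Context: For cosets $H_1,\dots,H_i$ of $H$ and $x\in\{0,1\}^{i-1}$, $H_i+\sum_{j=1}^{i-1}x_jH_j$ denotes the coset of $H$ obtained by adding the cosets $H_j$ with $x_j=1$ to $H_i$ in the quotient group $G/H$. (The paper writes the index set $\{0,1\}^{i-1}$ as $[0,1]^{i-1}$.) -}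

module Defs where

open import Data.Nat using (ℕ; zero; suc; _+_; _*_; _^_; NonZero)
open import Data.Nat.Properties using (m^n≢0)
open import Data.Nat.DivMod using (_mod_)
open import Data.Fin using (Fin; toℕ; Fin′; inject) renaming (zero to fzero; suc to fsuc)
open import Data.Vec using (Vec; []; _∷_)
open import Data.List using (List; []; _∷_; map; concatMap; length; applyUpTo; allFin)
open import Data.Nat.ListAction using (sum)
open import Data.Bool using (Bool; true; false; if_then_else_; _∧_)
open import Data.Product using (_×_; _,_)
open import Data.Unit using (⊤; tt)
open import Relation.Binary.PropositionalEquality using (_≡_)

ord : ℕ → ℕ
ord k = 2 ^ suc k

ord-nz : ∀ k → NonZero (ord k)
ord-nz k = m^n≢0 2 (suc k)

-- Elements of a cyclic factor: residues mod 2^(k+1) (x ↦ x / 2^(k+1) mod Z).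
Cyc : ℕ → Set
Cyc k = Fin (ord k)

cadd : ∀ k → Cyc k → Cyc k → Cyc k
cadd k a b = _mod_ (toℕ a + toℕ b) (ord k) {{ord-nz k}}

cneg : ∀ k → Cyc k → Cyc k
cneg k a = _mod_ (ord k Data.Nat.∸ toℕ a) (ord k) {{ord-nz k}}

czero : ∀ k → Cyc k
czero k = _mod_ 0 (ord k) {{ord-nz k}}

Grp : ∀ {n} → Vec ℕ n → Set
Grp []       = ⊤
Grp (k ∷ ks) = Cyc k × Grp ks

_⊕_ : ∀ {n} {ks : Vec ℕ n} → Grp ks → Grp ks → Grp ks
_⊕_ {ks = []}     tt       tt       = tt
_⊕_ {ks = k ∷ ks} (a , as) (b , bs) = cadd k a b , (as ⊕ bs)

⊖_ : ∀ {n} {ks : Vec ℕ n} → Grp ks → Grp ks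
⊖_ {ks = []}     tt       = tt
⊖_ {ks = k ∷ ks} (a , as) = cneg k a , (⊖ as)

𝟘 : ∀ {n} {ks : Vec ℕ n} → Grp ks
𝟘 {ks = []}     = tt
𝟘 {ks = k ∷ ks} = czero k , 𝟘

elems : ∀ {n} (ks : Vec ℕ n) → List (Grp ks)
elems []       = tt ∷ []
elems (k ∷ ks) = concatMap (λ a → map (a ,_) (elems ks)) (allFin (ord k))

Subset : ∀ {n} → Vec ℕ n → Set
Subset ks = Grp ks → Bool

card : ∀ {n} {ks : Vec ℕ n} → Subset ks → ℕ
card {ks = ks} S = sum (map (λ g → if S g then 1 else 0) (elems ks))

order : ∀ {n} (ks : Vec ℕ n) → ℕ
order ks = length (elems ks)

_∩_ : ∀ {n} {ks : Vec ℕ n} → Subset ks → Subset ks → Subset ks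
(S ∩ T) g = S g ∧ T g

record Subgroup {n} (ks : Vec ℕ n) : Set where
  field
    mem      : Subset ks
    mem-𝟘    : mem 𝟘 ≡ true
    mem-⊕    : ∀ a b → mem a ≡ true → mem b ≡ true → mem (a ⊕ b) ≡ true
    mem-⊖    : ∀ a → mem a ≡ true → mem (⊖ a) ≡ true
open Subgroup public

coset : ∀ {n} {ks : Vec ℕ n} → Subgroup ks → Grp ks → Subset ks
coset H g y = mem H (y ⊕ (⊖ g))

boolVecs : (m : ℕ) → List (Vec Bool m)
boolVecs zero    = [] ∷ []
boolVecs (suc m) = concatMap (λ b → map (b ∷_) (boolVecs m)) (true ∷ false ∷ [])

-- Σ_{j=1}^{m} x_j 2^(j-1)  (x_1 is the head of the vector).
bin : ∀ {m} → Vec Bool m → ℕ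
bin []       = 0
bin (b ∷ bs) = (if b then 1 else 0) + 2 * bin bs

selSum : ∀ {n} {ks : Vec ℕ n} {m} → Vec Bool m → (Fin m → Grp ks) → Grp ks
selSum []       f = 𝟘
selSum (b ∷ bs) f = (if b then f fzero else 𝟘) ⊕ selSum bs (λ j → f (fsuc j))

-- Choose the cosets greedily. Once H_1, …, H_{i-1} are fixed, sum the i-th left-hand
-- side over all g ∈ G with H_i = g + H: for every subset S and shift s the translates
-- S ∩ (g + s + H) count each pair (y ∈ S, h ∈ H) exactly once, so the total is
-- |H| · Σ_x |M_{2^(i-1)+bin x}|, and as x runs over {0,1}^(i-1) the index 2^(i-1) + bin x
-- runs over [2^(i-1), 2^i). Some g therefore reaches at least the average over G.
module Submission where

open import Defs
open import Data.Nat using (ℕ; zero; suc; _+_; _*_; _^_; _≤_; _<_; _∸_; NonZero; _%_; _≤?_; _<?_; z≤n; s≤s⁻¹)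
open import Data.Nat.Properties
  using (+-comm; +-assoc; +-identityʳ; +-suc; *-comm; *-distribʳ-+; *-monoʳ-≤; +-monoʳ-≤; +-mono-≤;
         ≤-trans; <⇒≤; ≰⇒>; ≤∧≮⇒≡; m+[n∸m]≡n; +-0-commutativeMonoid)
open import Data.Nat.DivMod using (%-distribˡ-+; m%n%n≡m%n; m<n⇒m%n≡m; [m+n]%n≡m%n; m%n<n)
open import Data.Fin using (Fin; toℕ; inject) renaming (zero to fzero; suc to fsuc)
open import Data.Fin.Properties using (toℕ-injective; toℕ-fromℕ<; toℕ<n; toℕ-inject)
open import Data.Fin.Permutation using (permutation)
open import Data.Vec using (Vec; []; _∷_)
open import Data.List using (List; []; _∷_; map; concatMap; length; applyUpTo; allFin; tabulate; _++_)
open import Data.List.Properties using (map-cong; map-∘; map-++; ++-identityʳ)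
open import Data.Nat.ListAction using (sum)
open import Data.Nat.ListAction.Properties using (sum-++)
open import Data.Bool using (Bool; true; false; if_then_else_; _∧_)
open import Data.Product using (Σ; _×_; _,_; proj₁; proj₂)
open import Function using (_∘_)
open import Relation.Nullary using (yes; no)
open import Relation.Binary.PropositionalEquality
open import Algebra.Properties.CommutativeMonoid.Sum +-0-commutativeMonoid using (sum-permute)
  renaming (sum to ∑)
open ≡-Reasoning

sum-map-0 : ∀ {A : Set} (xs : List A) → sum (map (λ _ → 0) xs) ≡ 0
sum-map-0 []       = refl
sum-map-0 (x ∷ xs) = sum-map-0 xs

sum-map-+ : ∀ {A : Set} (f g : A → ℕ) (xs : List A) →
  sum (map (λ x → f x + g x) xs) ≡ sum (map f xs) + sum (map g xs)
sum-map-+ f g []       = refl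
sum-map-+ f g (x ∷ xs) = begin
  f x + g x + sum (map (λ x → f x + g x) xs)    ≡⟨ cong (f x + g x +_) (sum-map-+ f g xs) ⟩
  f x + g x + (sum (map f xs) + sum (map g xs)) ≡⟨ +-assoc (f x) (g x) _ ⟩
  f x + (g x + (sum (map f xs) + sum (map g xs))) ≡⟨ cong (f x +_) (+-assoc (g x) _ _) ⟨
  f x + (g x + sum (map f xs) + sum (map g xs)) ≡⟨ cong (λ t → f x + (t + sum (map g xs))) (+-comm (g x) _) ⟩
  f x + (sum (map f xs) + g x + sum (map g xs)) ≡⟨ cong (f x +_) (+-assoc (sum (map f xs)) (g x) _) ⟩
  f x + (sum (map f xs) + (g x + sum (map g xs))) ≡⟨ +-assoc (f x) _ _ ⟨
  f x + sum (map f xs) + (g x + sum (map g xs)) ∎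

sum-map-*ʳ : ∀ {A : Set} (f : A → ℕ) (c : ℕ) (xs : List A) →
  sum (map (λ x → f x * c) xs) ≡ sum (map f xs) * c
sum-map-*ʳ f c []       = refl
sum-map-*ʳ f c (x ∷ xs) =
  trans (cong (f x * c +_) (sum-map-*ʳ f c xs)) (sym (*-distribʳ-+ c (f x) (sum (map f xs))))

sum-map-comm : ∀ {A B : Set} (f : A → B → ℕ) (xs : List A) (ys : List B) →
  sum (map (λ x → sum (map (f x) ys)) xs) ≡ sum (map (λ y → sum (map (λ x → f x y) xs)) ys)
sum-map-comm f []       ys = sym (sum-map-0 ys)
sum-map-comm f (x ∷ xs) ys = begin
  sum (map (f x) ys) + sum (map (λ x → sum (map (f x) ys)) xs)
    ≡⟨ cong (sum (map (f x) ys) +_) (sum-map-comm f xs ys) ⟩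
  sum (map (f x) ys) + sum (map (λ y → sum (map (λ x → f x y) xs)) ys)
    ≡⟨ sum-map-+ (f x) (λ y → sum (map (λ x → f x y) xs)) ys ⟨
  sum (map (λ y → sum (map (λ x → f x y) (x ∷ xs))) ys) ∎

sum-map-pairs : ∀ {A B : Set} (f : A × B → ℕ) (xs : List A) (ys : List B) →
  sum (map f (concatMap (λ a → map (a ,_) ys) xs)) ≡ sum (map (λ a → sum (map (λ b → f (a , b)) ys)) xs)
sum-map-pairs f []       ys = refl
sum-map-pairs f (x ∷ xs) ys = begin
  sum (map f (map (x ,_) ys ++ pairs))             ≡⟨ cong sum (map-++ f (map (x ,_) ys) pairs) ⟩
  sum (map f (map (x ,_) ys) ++ map f pairs)       ≡⟨ sum-++ (map f (map (x ,_) ys)) (map f pairs) ⟩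
  sum (map f (map (x ,_) ys)) + sum (map f pairs)
    ≡⟨ cong₂ _+_ (cong sum (sym (map-∘ ys))) (sum-map-pairs f xs ys) ⟩
  sum (map (λ b → f (x , b)) ys) + sum (map (λ a → sum (map (λ b → f (a , b)) ys)) xs) ∎
  where pairs = concatMap (λ a → map (a ,_) ys) xs

sum-map-tabulate : ∀ {A : Set} {n} (g : Fin n → A) (f : A → ℕ) → sum (map f (tabulate g)) ≡ ∑ (f ∘ g)
sum-map-tabulate {n = zero}  g f = refl
sum-map-tabulate {n = suc n} g f = cong (f (g fzero) +_) (sum-map-tabulate (g ∘ fsuc) f)

sum-allFin-involution : ∀ {n} (ψ : Fin n → Fin n) → (∀ a → ψ (ψ a) ≡ a) → (f : Fin n → ℕ) →
  sum (map (f ∘ ψ) (allFin n)) ≡ sum (map f (allFin n))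
sum-allFin-involution {n} ψ invol f = begin
  sum (map (f ∘ ψ) (allFin n)) ≡⟨ sum-map-tabulate (λ a → a) (f ∘ ψ) ⟩
  ∑ (f ∘ ψ)                    ≡⟨ sum-permute f (permutation ψ ψ invol invol) ⟨
  ∑ f                          ≡⟨ sum-map-tabulate (λ a → a) f ⟨
  sum (map f (allFin n))       ∎

∃-average≤ : ∀ {A : Set} (d : A) (f : A → ℕ) (xs : List A) → Σ A λ a → sum (map f xs) ≤ length xs * f a
∃-average≤ d f [] = d , z≤n
∃-average≤ d f (x ∷ xs) with ∃-average≤ d f xs
... | a , avg≤ with f a ≤? f x
...   | yes fa≤fx = x , +-monoʳ-≤ (f x) (≤-trans avg≤ (*-monoʳ-≤ (length xs) fa≤fx))
...   | no  fa≰fx = a , +-mono-≤ (<⇒≤ (≰⇒> fa≰fx)) avg≤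

sum-applyUpTo-cong : ∀ {f g : ℕ → ℕ} n → (∀ t → f t ≡ g t) → sum (applyUpTo f n) ≡ sum (applyUpTo g n)
sum-applyUpTo-cong zero    f≗g = refl
sum-applyUpTo-cong (suc n) f≗g = cong₂ _+_ (f≗g 0) (sum-applyUpTo-cong n (f≗g ∘ suc))

sum-applyUpTo-odd+even : ∀ n (f : ℕ → ℕ) →
  sum (applyUpTo f (2 * n)) ≡ sum (applyUpTo (λ t → f (1 + 2 * t)) n) + sum (applyUpTo (λ t → f (2 * t)) n)
sum-applyUpTo-odd+even zero    f = refl
sum-applyUpTo-odd+even (suc n) f = begin
  sum (applyUpTo f (2 * suc n))                       ≡⟨ cong (sum ∘ applyUpTo f) (2*suc n) ⟩
  f 0 + (f 1 + sum (applyUpTo (f ∘ suc ∘ suc) (2 * n))) ≡⟨ cong (λ t → f 0 + (f 1 + t)) (sum-applyUpTo-odd+even n (f ∘ suc ∘ suc)) ⟩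
  f 0 + (f 1 + (odd + even))                           ≡⟨ interchange (f 0) (f 1) odd even ⟩
  (f 1 + odd) + (f 0 + even)
    ≡⟨ cong₂ (λ a b → (f 1 + a) + (f 0 + b)) (sum-applyUpTo-cong n (λ t → cong (f ∘ suc) (sym (2*suc t))))
                                              (sum-applyUpTo-cong n (λ t → cong f (sym (2*suc t)))) ⟩
  sum (applyUpTo (λ t → f (1 + 2 * t)) (suc n)) + sum (applyUpTo (λ t → f (2 * t)) (suc n)) ∎
  where
  odd  = sum (applyUpTo (λ t → f (suc (suc (1 + 2 * t)))) n)
  even = sum (applyUpTo (λ t → f (suc (suc (2 * t)))) n)
  2*suc : ∀ t → 2 * suc t ≡ suc (suc (2 * t))
  2*suc t = cong suc (+-suc t (t + 0))
  interchange : ∀ a b c d → a + (b + (c + d)) ≡ (b + c) + (a + d)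
  interchange a b c d = begin
    a + (b + (c + d)) ≡⟨ cong (a +_) (+-assoc b c d) ⟨
    a + ((b + c) + d) ≡⟨ cong (a +_) (+-comm (b + c) d) ⟩
    a + (d + (b + c)) ≡⟨ +-assoc a d (b + c) ⟨
    (a + d) + (b + c) ≡⟨ +-comm (a + d) (b + c) ⟩
    (b + c) + (a + d) ∎

sum-boolVecs-bin : ∀ m (f : ℕ → ℕ) → sum (map (f ∘ bin) (boolVecs m)) ≡ sum (applyUpTo f (2 ^ m))
sum-boolVecs-bin zero    f = refl
sum-boolVecs-bin (suc m) f = begin
  sum (map (f ∘ bin) (map (true ∷_) bs ++ (map (false ∷_) bs ++ [])))
    ≡⟨ cong (λ l → sum (map (f ∘ bin) (map (true ∷_) bs ++ l))) (++-identityʳ (map (false ∷_) bs)) ⟩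
  sum (map (f ∘ bin) (map (true ∷_) bs ++ map (false ∷_) bs))
    ≡⟨ cong sum (map-++ (f ∘ bin) (map (true ∷_) bs) _) ⟩
  sum (map (f ∘ bin) (map (true ∷_) bs) ++ map (f ∘ bin) (map (false ∷_) bs))
    ≡⟨ sum-++ (map (f ∘ bin) (map (true ∷_) bs)) _ ⟩
  sum (map (f ∘ bin) (map (true ∷_) bs)) + sum (map (f ∘ bin) (map (false ∷_) bs))
    ≡⟨ cong₂ _+_ (cong sum (sym (map-∘ bs))) (cong sum (sym (map-∘ bs))) ⟩
  sum (map (λ x → f (1 + 2 * bin x)) bs) + sum (map (λ x → f (2 * bin x)) bs)
    ≡⟨ cong₂ _+_ (sum-boolVecs-bin m (λ t → f (1 + 2 * t))) (sum-boolVecs-bin m (λ t → f (2 * t))) ⟩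
  sum (applyUpTo (λ t → f (1 + 2 * t)) (2 ^ m)) + sum (applyUpTo (λ t → f (2 * t)) (2 ^ m))
    ≡⟨ sum-applyUpTo-odd+even (2 ^ m) f ⟨
  sum (applyUpTo f (2 ^ suc m)) ∎
  where bs = boolVecs m

module ModularArithmetic (N : ℕ) .{{_ : NonZero N}} where

  %-absorbˡ : ∀ x z → (x % N + z) % N ≡ (x + z) % N
  %-absorbˡ x z = begin
    (x % N + z) % N           ≡⟨ %-distribˡ-+ (x % N) z N ⟩
    (x % N % N + z % N) % N   ≡⟨ cong (λ t → (t + z % N) % N) (m%n%n≡m%n x N) ⟩
    (x % N + z % N) % N       ≡⟨ %-distribˡ-+ x z N ⟨
    (x + z) % N               ∎

  %-absorbʳ : ∀ x z → (x + z % N) % N ≡ (x + z) % N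
  %-absorbʳ x z = begin
    (x + z % N) % N ≡⟨ cong (_% N) (+-comm x (z % N)) ⟩
    (z % N + x) % N ≡⟨ %-absorbˡ z x ⟩
    (z + x) % N     ≡⟨ cong (_% N) (+-comm z x) ⟩
    (x + z) % N     ∎

  [m+N]%N≡m : ∀ {m} → m < N → (m + N) % N ≡ m
  [m+N]%N≡m {m} m<N = trans ([m+n]%n≡m%n m N) (m<n⇒m%n≡m m<N)

  -- Adding r = N ∸ K % N undoes the shift by K.
  +-cancelʳ-% : ∀ {u v} K → u < N → v < N → (u + K) % N ≡ (v + K) % N → u ≡ v
  +-cancelʳ-% {u} {v} K u<N v<N eq = begin
    u                       ≡⟨ [m+N]%N≡m u<N ⟨
    (u + N) % N             ≡⟨ unshift u ⟨
    ((u + K) % N + r) % N   ≡⟨ cong (λ t → (t + r) % N) eq ⟩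
    ((v + K) % N + r) % N   ≡⟨ unshift v ⟩
    (v + N) % N             ≡⟨ [m+N]%N≡m v<N ⟩
    v                       ∎
    where
    r = N ∸ K % N
    unshift : ∀ w → ((w + K) % N + r) % N ≡ (w + N) % N
    unshift w = begin
      ((w + K) % N + r) % N       ≡⟨ %-absorbˡ (w + K) r ⟩
      (w + K + r) % N             ≡⟨ cong (_% N) (+-assoc w K r) ⟩
      (w + (K + r)) % N           ≡⟨ %-absorbʳ w (K + r) ⟨
      (w + (K + r) % N) % N       ≡⟨ cong (λ t → (w + t) % N) (%-absorbˡ K r) ⟨
      (w + (K % N + r) % N) % N   ≡⟨ cong (λ t → (w + t % N) % N) (m+[n∸m]≡n (<⇒≤ (m%n<n K N))) ⟩
      (w + N % N) % N             ≡⟨ %-absorbʳ w N ⟩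
      (w + N) % N                 ∎

module Cyclic (k : ℕ) where
  private
    N = ord k
    instance
      N-nonZero : NonZero N
      N-nonZero = ord-nz k
  open ModularArithmetic N

  toℕ-cadd : ∀ a b → toℕ (cadd k a b) ≡ (toℕ a + toℕ b) % N
  toℕ-cadd a b = toℕ-fromℕ< _

  toℕ-cneg : ∀ a → toℕ (cneg k a) ≡ (N ∸ toℕ a) % N
  toℕ-cneg a = toℕ-fromℕ< _

  cadd-cneg-cancel : ∀ y w → (toℕ (cadd k y (cneg k w)) + toℕ w) % N ≡ toℕ y
  cadd-cneg-cancel y w = begin
    (toℕ (cadd k y (cneg k w)) + W) % N   ≡⟨ cong (λ t → (t + W) % N) (toℕ-cadd y (cneg k w)) ⟩
    ((Y + toℕ (cneg k w)) % N + W) % N    ≡⟨ %-absorbˡ (Y + toℕ (cneg k w)) W ⟩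
    (Y + toℕ (cneg k w) + W) % N          ≡⟨ cong (λ t → (Y + t + W) % N) (toℕ-cneg w) ⟩
    (Y + (N ∸ W) % N + W) % N             ≡⟨ cong (_% N) (+-assoc Y _ W) ⟩
    (Y + ((N ∸ W) % N + W)) % N           ≡⟨ %-absorbʳ Y _ ⟨
    (Y + ((N ∸ W) % N + W) % N) % N       ≡⟨ cong (λ t → (Y + t) % N) (%-absorbˡ (N ∸ W) W) ⟩
    (Y + (N ∸ W + W) % N) % N             ≡⟨ cong (λ t → (Y + t % N) % N) (trans (+-comm (N ∸ W) W) (m+[n∸m]≡n (<⇒≤ (toℕ<n w)))) ⟩
    (Y + N % N) % N                       ≡⟨ %-absorbʳ Y N ⟩
    (Y + N) % N                           ≡⟨ [m+N]%N≡m (toℕ<n y) ⟩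
    Y                                     ∎
    where
    Y = toℕ y
    W = toℕ w

  reflect : Cyc k → Cyc k → Cyc k → Cyc k
  reflect y s a = cadd k y (cneg k (cadd k a s))

  -- The relation a + b + s ≡ y (mod N) defining b = reflect y s a is symmetric in a and b.
  reflect-involutive : ∀ y s a → reflect y s (reflect y s a) ≡ a
  reflect-involutive y s a = toℕ-injective (+-cancelʳ-% (toℕ b + toℕ s) (toℕ<n _) (toℕ<n a) (begin
    (toℕ (reflect y s b) + (toℕ b + toℕ s)) % N ≡⟨ sum≡y b ⟩
    toℕ y                                       ≡⟨ sum≡y a ⟨
    (toℕ b + (toℕ a + toℕ s)) % N               ≡⟨ cong (_% N) (+-assoc (toℕ b) _ _) ⟨
    (toℕ b + toℕ a + toℕ s) % N                 ≡⟨ cong (λ t → (t + toℕ s) % N) (+-comm (toℕ b) (toℕ a)) ⟩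
    (toℕ a + toℕ b + toℕ s) % N                 ≡⟨ cong (_% N) (+-assoc (toℕ a) _ _) ⟩
    (toℕ a + (toℕ b + toℕ s)) % N               ∎))
    where
    b = reflect y s a
    sum≡y : ∀ c → (toℕ (reflect y s c) + (toℕ c + toℕ s)) % N ≡ toℕ y
    sum≡y c = begin
      (toℕ (reflect y s c) + (toℕ c + toℕ s)) % N       ≡⟨ %-absorbʳ (toℕ (reflect y s c)) _ ⟨
      (toℕ (reflect y s c) + (toℕ c + toℕ s) % N) % N   ≡⟨ cong (λ t → (toℕ (reflect y s c) + t) % N) (toℕ-cadd c s) ⟨
      (toℕ (reflect y s c) + toℕ (cadd k c s)) % N      ≡⟨ cadd-cneg-cancel y (cadd k c s) ⟩
      toℕ y                                             ∎

sum-elems-∷ : ∀ {n} k (ks : Vec ℕ n) (f : Grp (k ∷ ks) → ℕ) →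
  sum (map f (elems (k ∷ ks))) ≡ sum (map (λ a → sum (map (λ b → f (a , b)) (elems ks))) (allFin (ord k)))
sum-elems-∷ k ks f = sum-map-pairs f (allFin (ord k)) (elems ks)

sum-elems-reflect : ∀ {n} (ks : Vec ℕ n) (f : Grp ks → ℕ) (y s : Grp ks) →
  sum (map (λ g → f (y ⊕ (⊖ (g ⊕ s)))) (elems ks)) ≡ sum (map f (elems ks))
sum-elems-reflect []       f y s = refl
sum-elems-reflect (k ∷ ks) f (y , ys) (s , ss) = begin
  sum (map reflected (elems (k ∷ ks)))
    ≡⟨ sum-elems-∷ k ks reflected ⟩
  sum (map (λ a → sum (map (λ b → f (reflect y s a , ys ⊕ (⊖ (b ⊕ ss)))) (elems ks))) (allFin (ord k)))
    ≡⟨ cong sum (map-cong (λ a → sum-elems-reflect ks (λ b → f (reflect y s a , b)) ys ss) (allFin (ord k))) ⟩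
  sum (map (λ a → sum (map (λ b → f (reflect y s a , b)) (elems ks))) (allFin (ord k)))
    ≡⟨ sum-allFin-involution (reflect y s) (reflect-involutive y s) (λ a → sum (map (λ b → f (a , b)) (elems ks))) ⟩
  sum (map (λ a → sum (map (λ b → f (a , b)) (elems ks))) (allFin (ord k)))
    ≡⟨ sum-elems-∷ k ks f ⟨
  sum (map f (elems (k ∷ ks))) ∎
  where
  open Cyclic k
  reflected : Grp (k ∷ ks) → ℕ
  reflected g = f (_⊕_ {ks = k ∷ ks} (y , ys) (⊖_ {ks = k ∷ ks} (_⊕_ {ks = k ∷ ks} g (s , ss))))

indicator : Bool → ℕ
indicator b = if b then 1 else 0

sum-card-∩-translate : ∀ {n} (ks : Vec ℕ n) (S T : Subset ks) (s : Grp ks) →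
  sum (map (λ g → card (S ∩ (λ y → T (y ⊕ (⊖ (g ⊕ s)))))) (elems ks)) ≡ card S * card T
sum-card-∩-translate ks S T s = begin
  sum (map (λ g → sum (map (λ y → indicator (S y ∧ T (y ⊕ (⊖ (g ⊕ s))))) G)) G)
    ≡⟨ sum-map-comm (λ g y → indicator (S y ∧ T (y ⊕ (⊖ (g ⊕ s))))) G G ⟩
  sum (map (λ y → sum (map (λ g → indicator (S y ∧ T (y ⊕ (⊖ (g ⊕ s))))) G)) G)
    ≡⟨ cong sum (map-cong fibre G) ⟩
  sum (map (λ y → indicator (S y) * card T) G)
    ≡⟨ sum-map-*ʳ (indicator ∘ S) (card T) G ⟩
  card S * card T ∎
  where
  G = elems ks
  fibre : ∀ y → sum (map (λ g → indicator (S y ∧ T (y ⊕ (⊖ (g ⊕ s))))) G) ≡ indicator (S y) * card T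
  fibre y with S y
  ... | true  = trans (sum-elems-reflect ks (indicator ∘ T) y s) (sym (+-identityʳ (card T)))
  ... | false = sum-map-0 G

selSum-cong : ∀ {n} {ks : Vec ℕ n} {m} (x : Vec Bool m) {h h′ : Fin m → Grp ks} →
  (∀ j → h j ≡ h′ j) → selSum x h ≡ selSum x h′
selSum-cong []      h≗h′ = refl
selSum-cong (b ∷ x) h≗h′ = cong₂ (λ u v → (if b then u else 𝟘) ⊕ v) (h≗h′ fzero) (selSum-cong x (h≗h′ ∘ fsuc))

module Greedy {n} (ks : Vec ℕ n) (H : Subgroup ks) (M : ℕ → Subset ks) where

  -- The i-th left-hand side (with m = i - 1), for earlier shifts h and candidate g.
  weight : (m : ℕ) → (Fin m → Grp ks) → Grp ks → ℕ
  weight m h g = sum (map (λ x → card (M (2 ^ m + bin x) ∩ coset H (g ⊕ selSum x h))) (boolVecs m))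

  target : ℕ → ℕ
  target m = card (mem H) * sum (applyUpTo (λ t → card (M (2 ^ m + t))) (2 ^ m))

  weight-cong : ∀ m {h h′} g → (∀ j → h j ≡ h′ j) → weight m h g ≡ weight m h′ g
  weight-cong m g h≗h′ =
    cong sum (map-cong (λ x → cong (λ v → card (M (2 ^ m + bin x) ∩ coset H (g ⊕ v))) (selSum-cong x h≗h′)) (boolVecs m))

  sum-weight : ∀ m h → sum (map (weight m h) (elems ks)) ≡ target m
  sum-weight m h = begin
    sum (map (weight m h) (elems ks))
      ≡⟨ sum-map-comm (λ g x → card (Mₓ x ∩ coset H (g ⊕ selSum x h))) (elems ks) (boolVecs m) ⟩
    sum (map (λ x → sum (map (λ g → card (Mₓ x ∩ coset H (g ⊕ selSum x h))) (elems ks))) (boolVecs m))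
      ≡⟨ cong sum (map-cong (λ x → sum-card-∩-translate ks (Mₓ x) (mem H) (selSum x h)) (boolVecs m)) ⟩
    sum (map (λ x → card (Mₓ x) * card (mem H)) (boolVecs m))
      ≡⟨ sum-map-*ʳ (card ∘ Mₓ) (card (mem H)) (boolVecs m) ⟩
    sum (map (card ∘ Mₓ) (boolVecs m)) * card (mem H)
      ≡⟨ cong (_* card (mem H)) (sum-boolVecs-bin m (λ t → card (M (2 ^ m + t)))) ⟩
    sum (applyUpTo (λ t → card (M (2 ^ m + t))) (2 ^ m)) * card (mem H)
      ≡⟨ *-comm _ (card (mem H)) ⟩
    target m ∎
    where
    Mₓ : Vec Bool m → Subset ks
    Mₓ x = M (2 ^ m + bin x)

  choose : (m : ℕ) → (Fin m → Grp ks) → Grp ks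
  choose m h = proj₁ (∃-average≤ 𝟘 (weight m h) (elems ks))

  choose-spec : ∀ m h → target m ≤ order ks * weight m h (choose m h)
  choose-spec m h = subst (_≤ order ks * weight m h (choose m h)) (sum-weight m h)
    (proj₂ (∃-average≤ 𝟘 (weight m h) (elems ks)))

  -- history m j is the j-th greedy choice when j < m; other values are junk.
  history : ℕ → ℕ → Grp ks
  history zero    j = 𝟘
  history (suc m) j with j <? m
  ... | yes _ = history m j
  ... | no  _ = choose m (history m ∘ toℕ)

  choice : ℕ → Grp ks
  choice m = choose m (history m ∘ toℕ)

  history-choice : ∀ {m j} → j < m → history m j ≡ choice j
  history-choice {suc m} {j} j<1+m with j <? m
  ... | yes j<m = history-choice j<m
  ... | no  j≮m with ≤∧≮⇒≡ (s≤s⁻¹ j<1+m) j≮m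
  ...   | refl = refl

  choice-spec : ∀ m → target m ≤ order ks * weight m (choice ∘ toℕ) (choice m)
  choice-spec m = subst (λ w → target m ≤ order ks * w)
    (weight-cong m (choice m) (λ j → history-choice (toℕ<n j)))
    (choose-spec m (history m ∘ toℕ))

mainTheorem1 : (n c : ℕ) → 1 ≤ n → 1 ≤ c → (ks : Vec ℕ n) →
    (H : Subgroup ks) → (M : ℕ → Subset ks) →
    Σ (Fin c → Grp ks) λ g → (i : Fin c) →
      card (mem H) * sum (applyUpTo (λ m → card (M (2 ^ toℕ i + m))) (2 ^ toℕ i))
        ≤ order ks * sum (map (λ x → card (M (2 ^ toℕ i + bin x) ∩ coset H (g i ⊕ selSum x (λ j → g (inject j))))) (boolVecs (toℕ i)))
mainTheorem1 n c _ _ ks H M = choice ∘ toℕ , λ i →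
  subst (λ w → target (toℕ i) ≤ order ks * w)
    (weight-cong (toℕ i) (choice (toℕ i)) (λ j → cong choice (sym (toℕ-inject j))))
    (choice-spec (toℕ i))
  where open Greedy ks H M
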